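{- Let $G$ be a finite simple connected graph. Then $$|\sigma^{\times}_V(G)-\sigma^{\square}_V(G)|\leq 1.$$
   Context: Let $G$ be a finite simple connected graph with distance function $d_G$. For $l\in\mathbb{N}$ let $\mathbb{N}_l=\{1,\dots,l\}$. An $l$-track on $G$ is a surjective function $f:\mathbb{N}_l\to V(G)$ with $f(i)f(i+1)\in E(G)$ for all $i\in\{1,\dots,l-1\}$. A lazy $l$-track on $G$ is a surjective function $f:\mathbb{N}_l\to V(G)$ such that for each $i\in\{1,\dots,l-1\}$, $f(i)f(i+1)\in E(G)$ or $f(i)=f(i+1)$. Two lazy $l$-tracks $f,g$ are opposite lazy $l$-tracks if for every $i\in\{1,\dots,l-1\}$, either ($f(i)f(i+1)\in E(G)$ and $g(i)=g(i+1)$) or ($g(i)g(i+1)\in E(G)$ and $f(i)=f(i+1)$). For two functions $f,g:\mathbb{N}_l\to V(G)$ let $m_G(f,g)=\min\{d_G(f(i),g(i)): i\in\mathbb{N}_l\}$. The direct vertex span $\sigma^{\times}_V(G)$ is the maximum of $m_G(f,g)$ over all $l\in\mathbb{N}$ and all pairs $f,g$ of $l$-tracks on $G$ (with the same $l$). The Cartesian vertex span $\sigma^{\square}_V(G)$ is the maximum of $m_G(f,g)$ over all $l\in\mathbb{N}$ and all pairs $(f,g)$ of opposite lazy $l$-tracks on $G$. -}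

module Defs where

open import Data.Nat using (ℕ; zero; suc; _≤_)
open import Data.Fin using (Fin; toℕ)
open import Data.Product using (Σ; ∃; _×_; _,_)
open import Data.Sum using (_⊎_)
open import Relation.Binary.PropositionalEquality using (_≡_)
open import Relation.Nullary using (¬_; Dec)

record Graph : Set₁ where
  field
    n       : ℕ
    Adj     : Fin n → Fin n → Set
    adj?    : ∀ u v → Dec (Adj u v)
    symm    : ∀ {u v} → Adj u v → Adj v u
    irrefl  : ∀ {u} → ¬ Adj u u

  V : Set
  V = Fin n

  data Walk : V → V → ℕ → Set where
    nil  : ∀ {u} → Walk u u zero
    cons : ∀ {u v w k} → Adj u v → Walk v w k → Walk u w (suc k)

  Dist : V → V → ℕ → Set
  Dist u v k = Walk u v k × (∀ j → Walk u v j → k ≤ j)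

open Graph public

record ConnectedGraph : Set₁ where
  field
    graph     : Graph
    nonempty  : Fin (n graph)
    connected : ∀ u v → ∃ λ k → Walk graph u v k

open ConnectedGraph public

module _ (G : Graph) where

  Surjective : ∀ {l} → (Fin l → V G) → Set
  Surjective {l} f = ∀ v → ∃ λ (i : Fin l) → f i ≡ v

  Consecutive : ∀ {l} → Fin l → Fin l → Set
  Consecutive i j = toℕ j ≡ suc (toℕ i)

  IsTrack : ∀ {l} → (Fin l → V G) → Set
  IsTrack {l} f = Surjective f × (∀ i j → Consecutive i j → Adj G (f i) (f j))

  IsLazyTrack : ∀ {l} → (Fin l → V G) → Set
  IsLazyTrack {l} f =
    Surjective f × (∀ i j → Consecutive i j → Adj G (f i) (f j) ⊎ f i ≡ f j)

  AreOpposite : ∀ {l} → (Fin l → V G) → (Fin l → V G) → Set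
  AreOpposite {l} f g =
    IsLazyTrack f × IsLazyTrack g ×
    (∀ i j → Consecutive i j →
      (Adj G (f i) (f j) × g i ≡ g j) ⊎ (Adj G (g i) (g j) × f i ≡ f j))

  MinDist : ∀ {l} → (Fin l → V G) → (Fin l → V G) → ℕ → Set
  MinDist {l} f g k =
    (∃ λ (i : Fin l) → Dist G (f i) (g i) k) ×
    (∀ (i : Fin l) d → Dist G (f i) (g i) d → k ≤ d)

  IsDirectVertexSpan : ℕ → Set
  IsDirectVertexSpan s =
    (Σ ℕ λ l → Σ (Fin l → V G) λ f → Σ (Fin l → V G) λ g →
       IsTrack f × IsTrack g × MinDist f g s) ×
    (∀ l (f g : Fin l → V G) → IsTrack f → IsTrack g →
       ∀ k → MinDist f g k → k ≤ s)

  IsCartesianVertexSpan : ℕ → Set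
  IsCartesianVertexSpan s =
    (Σ ℕ λ l → Σ (Fin l → V G) λ f → Σ (Fin l → V G) λ g →
       AreOpposite f g × MinDist f g s) ×
    (∀ l (f g : Fin l → V G) → AreOpposite f g →
       ∀ k → MinDist f g k → k ≤ s)

-- Read a pair of tracks (f, g) as a walk i ↦ (f i, g i) in V × V: for l-tracks both
-- coordinates move at every step, for opposite lazy tracks exactly one does.  A direct
-- step (a, b) → (a′, b′) splits into the Cartesian steps (a, b) → (a′, b) → (a′, b′).
-- Conversely, two consecutive Cartesian steps merge into one direct step when they move
-- different coordinates; when they move the same one, the idle coordinate b visits a
-- neighbour of b and comes back.  Every pair introduced this way differs from a pair of
-- the original walk by one edge in one coordinate, so the minimum distance drops by at
-- most one in either direction, and each span is at most one more than the other.
module Submission where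

open import Defs
open import Data.Nat using (ℕ; zero; suc; _≤_; _<_; z≤n; s≤s; ∣_-_∣)
open import Data.Nat.Properties using (≤-trans; ≤-pred; <⇒≤; ≮⇒≥; suc-injective)
open import Data.Nat.Induction using (<-rec)
open import Data.Fin using (Fin; zero; suc; toℕ; fromℕ<)
open import Data.Fin.Properties using (_≟_; any?; toℕ<n; toℕ-fromℕ<)
open import Data.Product as Product using (∃; _×_; _,_; proj₁; proj₂)
open import Data.Sum as Sum using (_⊎_; inj₁; inj₂)
open import Data.List using (List; []; _∷_; length; lookup; tabulate; allFin)
open import Data.List.Relation.Unary.Any as Any using (Any; here; there)
import Data.List.Relation.Unary.Any.Properties as Anyₚ
open import Data.List.Relation.Unary.All as All using (All; []; _∷_)
import Data.List.Relation.Unary.All.Properties as Allₚ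
open import Data.List.Relation.Unary.Linked using (Linked; []; [-]; _∷_)
open import Data.List.Membership.Propositional.Properties using (∈-lookup; ∈-allFin)
open import Data.List.Relation.Binary.Subset.Propositional using (_⊆_)
open import Data.List.Relation.Binary.Subset.Propositional.Properties using (Any-resp-⊆)
open import Data.List.Membership.Propositional using (lose)
open import Data.List.Extrema.Nat using (argmin; f[argmin]≤v⁺)
open import Function using (_∘_)
open import Relation.Binary.PropositionalEquality using (_≡_; refl; sym; cong; subst)
open import Relation.Nullary using (Dec; yes; no)
open import Relation.Nullary.Decidable using (_×-dec_)

m≤1+n⇒n≤1+m⇒∣m-n∣≤1 : ∀ {m n} → m ≤ suc n → n ≤ suc m → ∣ m - n ∣ ≤ 1
m≤1+n⇒n≤1+m⇒∣m-n∣≤1 {zero}        {zero}        _         _         = z≤n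
m≤1+n⇒n≤1+m⇒∣m-n∣≤1 {zero}        {suc zero}    _         _         = s≤s z≤n
m≤1+n⇒n≤1+m⇒∣m-n∣≤1 {suc zero}    {zero}        _         _         = s≤s z≤n
m≤1+n⇒n≤1+m⇒∣m-n∣≤1 {zero}        {suc (suc n)} _         (s≤s ())
m≤1+n⇒n≤1+m⇒∣m-n∣≤1 {suc (suc m)} {zero}        (s≤s ())  _
m≤1+n⇒n≤1+m⇒∣m-n∣≤1 {suc m}       {suc n}       (s≤s m≤n) (s≤s n≤m) = m≤1+n⇒n≤1+m⇒∣m-n∣≤1 m≤n n≤m

least-witness : {P : ℕ → Set} → (∀ n → Dec (P n)) → ∀ {k} → P k →
                ∃ λ m → P m × (∀ j → P j → m ≤ j)
least-witness {P} P? {k} = <-rec (λ k → P k → Least) search k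
  where
  Least : Set
  Least = ∃ λ m → P m × (∀ j → P j → m ≤ j)

  search : ∀ k → (∀ {j} → j < k → P j → Least) → P k → Least
  search k below pk with any? (λ (j : Fin k) → P? (toℕ j))
  ... | yes (j , pj) = below (toℕ<n j) pj
  ... | no none = k , pk , λ j pj → ≮⇒≥ λ j<k →
          none (fromℕ< j<k , subst P (sym (toℕ-fromℕ< j<k)) pj)

module _ {A : Set} {R : A → A → Set} where

  Linked-tabulate⁺ : ∀ {n} {h : Fin n → A} →
                     (∀ i j → toℕ j ≡ suc (toℕ i) → R (h i) (h j)) → Linked R (tabulate h)
  Linked-tabulate⁺ {zero}        _ = []
  Linked-tabulate⁺ {suc zero}    _ = [-]
  Linked-tabulate⁺ {suc (suc n)} r =
    r zero (suc zero) refl ∷ Linked-tabulate⁺ λ i j e → r (suc i) (suc j) (cong suc e)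

  Linked-lookup : ∀ {xs} → Linked R xs →
                  ∀ i j → toℕ j ≡ suc (toℕ i) → R (lookup xs i) (lookup xs j)
  Linked-lookup (r ∷ _) zero    (suc zero)    _ = r
  Linked-lookup (_ ∷ l) (suc i) (suc j)       e = Linked-lookup l i j (suc-injective e)
  Linked-lookup [-]     zero    zero          ()
  Linked-lookup (_ ∷ _) zero    zero          ()
  Linked-lookup (_ ∷ _) zero    (suc (suc _)) ()
  Linked-lookup (_ ∷ _) (suc _) zero          ()

module _ (G : Graph) where

  walk? : ∀ k u v → Dec (Walk G u v k)
  walk? zero u v with u ≟ v
  ... | yes refl = yes nil
  ... | no u≢v   = no λ { nil → u≢v refl }
  walk? (suc k) u v with any? (λ w → adj? G u w ×-dec walk? k w v)
  ... | yes (w , e , p) = yes (cons e p)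
  ... | no  none        = no λ { (cons e p) → none (_ , e , p) }

module _ {G : Graph} where

  _∷ʳ_ : ∀ {u v w k} → Walk G u v k → Adj G v w → Walk G u w (suc k)
  nil      ∷ʳ e = cons e nil
  cons a p ∷ʳ e = cons a (p ∷ʳ e)

module _ (CG : ConnectedGraph) where

  private
    G : Graph
    G = graph CG

    shortest : ∀ u v → ∃ (Dist G u v)
    shortest u v = least-witness (λ k → walk? G k u v) (proj₂ (connected CG u v))

  dist : V G → V G → ℕ
  dist u v = proj₁ (shortest u v)

  dist-isDist : ∀ u v → Dist G u v (dist u v)
  dist-isDist u v = proj₂ (shortest u v)

  dist-minimal : ∀ {u v k} → Walk G u v k → dist u v ≤ k
  dist-minimal = proj₂ (dist-isDist _ _) _

  dist-stepʳ : ∀ {u v w} → Adj G w v → dist u v ≤ suc (dist u w)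
  dist-stepʳ e = dist-minimal (proj₁ (dist-isDist _ _) ∷ʳ e)

  dist-stepˡ : ∀ {u v w} → Adj G u w → dist u v ≤ suc (dist w v)
  dist-stepˡ e = dist-minimal (cons e (proj₁ (dist-isDist _ _)))

  neighbour : ∀ {a b} → Adj G a b → ∀ v → ∃ (Adj G v)
  neighbour {a} {b} e v with connected CG v a
  ... | _ , cons e′ _ = _ , e′
  ... | _ , nil       = b , e

  Pair : Set
  Pair = V G × V G

  pairDist : Pair → ℕ
  pairDist (a , b) = dist a b

  DirectStep : Pair → Pair → Set
  DirectStep (a , b) (a′ , b′) = Adj G a a′ × Adj G b b′

  data CartesianStep : Pair → Pair → Set where
    moveˡ : ∀ {a a′ b} → Adj G a a′ → CartesianStep (a , b) (a′ , b)
    moveʳ : ∀ {a b b′} → Adj G b b′ → CartesianStep (a , b) (a , b′)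

  Covering : List Pair → Set
  Covering xs = ∀ v → Any ((_≡ v) ∘ proj₁) xs × Any ((_≡ v) ∘ proj₂) xs

  Apart : ℕ → List Pair → Set
  Apart k = All λ p → k ≤ pairDist p

  record PairWalk (Step : Pair → Pair → Set) (k : ℕ) : Set where
    constructor pairWalk
    field
      start  : Pair
      rest   : List Pair
      linked : Linked Step (start ∷ rest)
      covers : Covering (start ∷ rest)
      apart  : Apart k (start ∷ rest)

    pairs : List Pair
    pairs = start ∷ rest

    firsts seconds : Fin (length pairs) → V G
    firsts  = proj₁ ∘ lookup pairs
    seconds = proj₂ ∘ lookup pairs

    firsts-surjective : Surjective G firsts
    firsts-surjective v = Any.index (proj₁ (covers v)) , Anyₚ.lookup-index (proj₁ (covers v))

    seconds-surjective : Surjective G seconds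
    seconds-surjective v = Any.index (proj₂ (covers v)) , Anyₚ.lookup-index (proj₂ (covers v))

    steps : ∀ i j → Consecutive G i j → Step (lookup pairs i) (lookup pairs j)
    steps = Linked-lookup linked

    closest : Fin (length pairs)
    closest = argmin (pairDist ∘ lookup pairs) zero (allFin _)

    closest-minDist : MinDist G firsts seconds (pairDist (lookup pairs closest))
    closest-minDist = (closest , dist-isDist _ _) , λ j d D →
      f[argmin]≤v⁺ {f = pairDist ∘ lookup pairs} zero (allFin _) (inj₂ (lose (∈-allFin j) (dist-minimal (proj₁ D))))

    apart-closest : k ≤ pairDist (lookup pairs closest)
    apart-closest = All.lookup apart (∈-lookup closest)

  tracks⇒pairWalk : ∀ {Step l k} (f g : Fin l → V G) → Surjective G f → Surjective G g →
                    (∀ i j → Consecutive G i j → Step (f i , g i) (f j , g j)) →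
                    MinDist G f g k → PairWalk Step k
  tracks⇒pairWalk {l = zero}  _ _ _      _      _     ((() , _) , _)
  tracks⇒pairWalk {l = suc _} f g f-surj g-surj steps (_ , minimal) =
    pairWalk (h zero) (tabulate (h ∘ suc)) (Linked-tabulate⁺ steps) covering
      (Allₚ.tabulate⁺ {f = h} λ i → minimal i _ (dist-isDist _ _))
    where
    h : Fin _ → Pair
    h i = f i , g i

    covering : Covering (tabulate h)
    covering v = Anyₚ.tabulate⁺ {f = h} (proj₁ (f-surj v)) (proj₂ (f-surj v))
               , Anyₚ.tabulate⁺ {f = h} (proj₁ (g-surj v)) (proj₂ (g-surj v))

  OppositeStep : Pair → Pair → Set
  OppositeStep (a , b) (a′ , b′) = (Adj G a a′ × b ≡ b′) ⊎ (Adj G b b′ × a ≡ a′)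

  CartesianStep⇒OppositeStep : ∀ {p q} → CartesianStep p q → OppositeStep p q
  CartesianStep⇒OppositeStep (moveˡ e) = inj₁ (e , refl)
  CartesianStep⇒OppositeStep (moveʳ e) = inj₂ (e , refl)

  OppositeStep⇒CartesianStep : ∀ {a b a′ b′} → OppositeStep (a , b) (a′ , b′) →
                               CartesianStep (a , b) (a′ , b′)
  OppositeStep⇒CartesianStep (inj₁ (e , refl)) = moveˡ e
  OppositeStep⇒CartesianStep (inj₂ (e , refl)) = moveʳ e

  directSpan-pairWalk : ∀ {s} → IsDirectVertexSpan G s → PairWalk DirectStep s
  directSpan-pairWalk ((_ , f , g , (f-surj , f-steps) , (g-surj , g-steps) , min) , _) =
    tracks⇒pairWalk f g f-surj g-surj (λ i j c → f-steps i j c , g-steps i j c) min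

  cartesianSpan-pairWalk : ∀ {t} → IsCartesianVertexSpan G t → PairWalk CartesianStep t
  cartesianSpan-pairWalk ((_ , f , g , ((f-surj , _) , (g-surj , _) , opposite) , min) , _) =
    tracks⇒pairWalk f g f-surj g-surj (λ i j c → OppositeStep⇒CartesianStep (opposite i j c)) min

  directSpan-bound : ∀ {s k} → IsDirectVertexSpan G s → PairWalk DirectStep k → k ≤ s
  directSpan-bound (_ , maximal) w = ≤-trans apart-closest
    (maximal _ firsts seconds (firsts-surjective , λ i j c → proj₁ (steps i j c))
                              (seconds-surjective , λ i j c → proj₂ (steps i j c)) _ closest-minDist)
    where open PairWalk w

  cartesianSpan-bound : ∀ {t k} → IsCartesianVertexSpan G t → PairWalk CartesianStep k → k ≤ t
  cartesianSpan-bound (_ , maximal) w = ≤-trans apart-closest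
    (maximal _ firsts seconds ((firsts-surjective , λ i j c → Sum.map proj₁ proj₂ (opposite i j c))
                             , (seconds-surjective , λ i j c → Sum.swap (Sum.map proj₂ proj₁ (opposite i j c)))
                             , opposite) _ closest-minDist)
    where
    open PairWalk w
    opposite : ∀ i j → Consecutive G i j → OppositeStep (lookup pairs i) (lookup pairs j)
    opposite i j c = CartesianStep⇒OppositeStep (steps i j c)

  interleave : Pair → List Pair → List Pair
  interleave _ []       = []
  interleave x (y ∷ ys) = (proj₁ y , proj₂ x) ∷ y ∷ interleave y ys

  interleave-linked : ∀ {x xs} → Linked DirectStep (x ∷ xs) →
                      Linked CartesianStep (x ∷ interleave x xs)
  interleave-linked [-]             = [-]
  interleave-linked ((ea , eb) ∷ l) = moveˡ ea ∷ moveʳ eb ∷ interleave-linked l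

  ⊆-interleave : ∀ x xs → x ∷ xs ⊆ x ∷ interleave x xs
  ⊆-interleave x xs       (here refl) = here refl
  ⊆-interleave x (y ∷ ys) (there p)   = there (there (⊆-interleave y ys p))

  interleave-apart : ∀ {k x xs} → Linked DirectStep (x ∷ xs) →
                     Apart (suc k) (x ∷ xs) → Apart k (x ∷ interleave x xs)
  interleave-apart [-]            (d ∷ [])      = <⇒≤ d ∷ []
  interleave-apart ((_ , eb) ∷ l) (d ∷ d′ ∷ ds) =
    <⇒≤ d ∷ ≤-pred (≤-trans d′ (dist-stepʳ eb)) ∷ interleave-apart l (d′ ∷ ds)

  direct⇒cartesian : ∀ {k} → PairWalk DirectStep (suc k) → PairWalk CartesianStep k
  direct⇒cartesian (pairWalk x xs linked covers apart) =
    pairWalk x (interleave x xs) (interleave-linked linked)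
      (λ v → Product.map (Any-resp-⊆ xs⊆) (Any-resp-⊆ xs⊆) (covers v))
      (interleave-apart linked apart)
    where
    xs⊆ : x ∷ xs ⊆ x ∷ interleave x xs
    xs⊆ = ⊆-interleave x xs

  module _ (neighbours : ∀ v → ∃ (Adj G v)) where

    private
      other : V G → V G
      other v = proj₁ (neighbours v)

      other-adj : ∀ v → Adj G v (other v)
      other-adj v = proj₂ (neighbours v)

      apart-otherˡ : ∀ {k a b} → suc k ≤ dist a b → k ≤ dist (other a) b
      apart-otherˡ {a = a} d = ≤-pred (≤-trans d (dist-stepˡ (other-adj a)))

      apart-otherʳ : ∀ {k a b} → suc k ≤ dist a b → k ≤ dist a (other b)
      apart-otherʳ {b = b} d = ≤-pred (≤-trans d (dist-stepʳ (symm G (other-adj b))))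

    pairSteps : ∀ {x xs} → Linked CartesianStep (x ∷ xs) → List Pair
    pairSteps [-]                                                = []
    pairSteps (moveˡ {a′ = a′} {b} _ ∷ [-])                       = (a′ , other b) ∷ []
    pairSteps (moveʳ {a = a} {b′ = b′} _ ∷ [-])                   = (other a , b′) ∷ []
    pairSteps (moveˡ _ ∷ moveʳ {a = a′} {b′ = b′} _ ∷ l)          = (a′ , b′) ∷ pairSteps l
    pairSteps (moveʳ _ ∷ moveˡ {a′ = a′} {b = b′} _ ∷ l)          = (a′ , b′) ∷ pairSteps l
    pairSteps (moveˡ {a′ = a′} {b} _ ∷ moveˡ {a′ = a″} _ ∷ l)     = (a′ , other b) ∷ (a″ , b) ∷ pairSteps l
    pairSteps (moveʳ {a = a} {b′ = b′} _ ∷ moveʳ {b′ = b″} _ ∷ l) = (other a , b′) ∷ (a , b″) ∷ pairSteps l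

    pairSteps-linked : ∀ {x xs} (l : Linked CartesianStep (x ∷ xs)) →
                       Linked DirectStep (x ∷ pairSteps l)
    pairSteps-linked [-]                             = [-]
    pairSteps-linked (moveˡ {b = b} e ∷ [-])         = (e , other-adj b) ∷ [-]
    pairSteps-linked (moveʳ {a = a} e ∷ [-])         = (other-adj a , e) ∷ [-]
    pairSteps-linked (moveˡ e ∷ moveʳ e′ ∷ l)        = (e , e′) ∷ pairSteps-linked l
    pairSteps-linked (moveʳ e ∷ moveˡ e′ ∷ l)        = (e′ , e) ∷ pairSteps-linked l
    pairSteps-linked (moveˡ {b = b} e ∷ moveˡ e′ ∷ l) =
      (e , other-adj b) ∷ (e′ , symm G (other-adj b)) ∷ pairSteps-linked l
    pairSteps-linked (moveʳ {a = a} e ∷ moveʳ e′ ∷ l) =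
      (other-adj a , e) ∷ (symm G (other-adj a) , e′) ∷ pairSteps-linked l

    pairSteps-covers₁ : ∀ {v x xs} (l : Linked CartesianStep (x ∷ xs)) →
                        Any ((_≡ v) ∘ proj₁) (x ∷ xs) → Any ((_≡ v) ∘ proj₁) (x ∷ pairSteps l)
    pairSteps-covers₁ [-]                      r                   = r
    pairSteps-covers₁ (_ ∷ _)                  (here q)            = here q
    pairSteps-covers₁ (moveˡ _ ∷ [-])          (there (here q))    = there (here q)
    pairSteps-covers₁ (moveʳ _ ∷ [-])          (there (here q))    = here q
    pairSteps-covers₁ (moveˡ _ ∷ moveʳ _ ∷ l)  (there (here q))    = there (pairSteps-covers₁ l (here q))
    pairSteps-covers₁ (moveʳ _ ∷ moveˡ _ ∷ _)  (there (here q))    = here q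
    pairSteps-covers₁ (moveˡ _ ∷ moveˡ _ ∷ _)  (there (here q))    = there (here q)
    pairSteps-covers₁ (moveʳ _ ∷ moveʳ _ ∷ _)  (there (here q))    = here q
    pairSteps-covers₁ (moveˡ _ ∷ moveʳ _ ∷ l)  (there (there r))   = there (pairSteps-covers₁ l r)
    pairSteps-covers₁ (moveʳ _ ∷ moveˡ _ ∷ l)  (there (there r))   = there (pairSteps-covers₁ l r)
    pairSteps-covers₁ (moveˡ _ ∷ moveˡ _ ∷ l)  (there (there r))   = there (there (pairSteps-covers₁ l r))
    pairSteps-covers₁ (moveʳ _ ∷ moveʳ _ ∷ l)  (there (there r))   = there (there (pairSteps-covers₁ l r))

    pairSteps-covers₂ : ∀ {v x xs} (l : Linked CartesianStep (x ∷ xs)) →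
                        Any ((_≡ v) ∘ proj₂) (x ∷ xs) → Any ((_≡ v) ∘ proj₂) (x ∷ pairSteps l)
    pairSteps-covers₂ [-]                      r                   = r
    pairSteps-covers₂ (_ ∷ _)                  (here q)            = here q
    pairSteps-covers₂ (moveˡ _ ∷ [-])          (there (here q))    = here q
    pairSteps-covers₂ (moveʳ _ ∷ [-])          (there (here q))    = there (here q)
    pairSteps-covers₂ (moveˡ _ ∷ moveʳ _ ∷ _)  (there (here q))    = here q
    pairSteps-covers₂ (moveʳ _ ∷ moveˡ _ ∷ l)  (there (here q))    = there (pairSteps-covers₂ l (here q))
    pairSteps-covers₂ (moveˡ _ ∷ moveˡ _ ∷ _)  (there (here q))    = here q
    pairSteps-covers₂ (moveʳ _ ∷ moveʳ _ ∷ _)  (there (here q))    = there (here q)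
    pairSteps-covers₂ (moveˡ _ ∷ moveʳ _ ∷ l)  (there (there r))   = there (pairSteps-covers₂ l r)
    pairSteps-covers₂ (moveʳ _ ∷ moveˡ _ ∷ l)  (there (there r))   = there (pairSteps-covers₂ l r)
    pairSteps-covers₂ (moveˡ _ ∷ moveˡ _ ∷ l)  (there (there r))   = there (there (pairSteps-covers₂ l r))
    pairSteps-covers₂ (moveʳ _ ∷ moveʳ _ ∷ l)  (there (there r))   = there (there (pairSteps-covers₂ l r))

    pairSteps-apart : ∀ {k x xs} (l : Linked CartesianStep (x ∷ xs)) →
                      Apart (suc k) (x ∷ xs) → Apart k (x ∷ pairSteps l)
    pairSteps-apart [-]                       (d ∷ [])      = <⇒≤ d ∷ []
    pairSteps-apart (moveˡ _ ∷ [-])           (d ∷ d′ ∷ []) = <⇒≤ d ∷ apart-otherʳ d′ ∷ []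
    pairSteps-apart (moveʳ _ ∷ [-])           (d ∷ d′ ∷ []) = <⇒≤ d ∷ apart-otherˡ d′ ∷ []
    pairSteps-apart (moveˡ _ ∷ moveʳ _ ∷ l)   (d ∷ _ ∷ ds)  = <⇒≤ d ∷ pairSteps-apart l ds
    pairSteps-apart (moveʳ _ ∷ moveˡ _ ∷ l)   (d ∷ _ ∷ ds)  = <⇒≤ d ∷ pairSteps-apart l ds
    pairSteps-apart (moveˡ _ ∷ moveˡ _ ∷ l)   (d ∷ d′ ∷ ds) = <⇒≤ d ∷ apart-otherʳ d′ ∷ pairSteps-apart l ds
    pairSteps-apart (moveʳ _ ∷ moveʳ _ ∷ l)   (d ∷ d′ ∷ ds) = <⇒≤ d ∷ apart-otherˡ d′ ∷ pairSteps-apart l ds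

  step-neighbours : ∀ {p q} → CartesianStep p q → ∀ v → ∃ (Adj G v)
  step-neighbours (moveˡ e) = neighbour e
  step-neighbours (moveʳ e) = neighbour e

  cartesian⇒direct : ∀ {k} → PairWalk CartesianStep (suc k) → PairWalk DirectStep k
  cartesian⇒direct (pairWalk x [] [-] covers apart) = pairWalk x [] [-] covers (All.map <⇒≤ apart)
  cartesian⇒direct (pairWalk x (_ ∷ _) linked@(step ∷ _) covers apart) =
    pairWalk x (pairSteps nb linked) (pairSteps-linked nb linked)
      (λ v → pairSteps-covers₁ nb linked (proj₁ (covers v))
           , pairSteps-covers₂ nb linked (proj₂ (covers v)))
      (pairSteps-apart nb linked apart)
    where
    nb : ∀ v → ∃ (Adj G v)
    nb = step-neighbours step

  ≤1+-by-transfer : ∀ {Step Step′ k t} → (∀ {j} → PairWalk Step (suc j) → PairWalk Step′ j) →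
                    (∀ {j} → PairWalk Step′ j → j ≤ t) → PairWalk Step k → k ≤ suc t
  ≤1+-by-transfer {k = zero}  _        _     _ = z≤n
  ≤1+-by-transfer {k = suc _} transfer bound w = s≤s (bound (transfer w))

theorem4p2 : (G : ConnectedGraph) (s t : ℕ) →
    IsDirectVertexSpan (graph G) s → IsCartesianVertexSpan (graph G) t →
    ∣ s - t ∣ ≤ 1
theorem4p2 G s t direct cartesian = m≤1+n⇒n≤1+m⇒∣m-n∣≤1
  (≤1+-by-transfer G (direct⇒cartesian G) (cartesianSpan-bound G cartesian) (directSpan-pairWalk G direct))
  (≤1+-by-transfer G (cartesian⇒direct G) (directSpan-bound G direct) (cartesianSpan-pairWalk G cartesian))
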